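{- Let $0\le i<j<x<n$ with $pen_{\alpha h}(i,x)>0$ and $pen_{\alpha h}(j,x)>0$. If $highest(j,x)\ne highest(j,x+1)$, then $pen_{\alpha h}(i,x+1)-pen_{\alpha h}(i,x)\le pen_{\alpha h}(j,x+1)-pen_{\alpha h}(j,x)$.
   Context: Customers $1,\dots,n$ in tour order with deliveries $d_z\ge 0$, pickups $p_z\ge0$; capacity $Q\ge 0$; penalty factor $\alpha\ge 0$. Let $P[k]=\sum_{z=1}^{k}p_z$, $D[k]=\sum_{z=1}^{k}d_z$. For $0\le i\le m\le k\le n$, $load(i,m,k)=P[m]-P[i]+D[k]-D[m]$. For $0\le i<k\le n$, $highest(i,k)$ is the largest index $m\in\{i,\dots,k\}$ maximizing $load(i,m,k)$ (ties broken toward the largest index), and $pen_{\alpha h}(i,k)=\alpha\max\big(load(i,highest(i,k),k)-Q,\,0\big)$.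
   Formalization: The deliveries $d_z$, the pickups $p_z$, the capacity $Q$ and the penalty factor $\alpha$ are all taken to be rational numbers. -}

module Defs where

open import Data.Nat as ℕ using (ℕ; zero; suc; _∸_)
open import Data.Bool using (if_then_else_)
open import Data.Rational using (ℚ; 0ℚ; _+_; _-_; _*_; _⊔_; _≤ᵇ_)

-- Prefix sums  S f k = f 1 + ... + f k  (f 0 is never used).
S : (ℕ → ℚ) → ℕ → ℚ
S f zero    = 0ℚ
S f (suc k) = S f k + f (suc k)

module _ (d p : ℕ → ℚ) where

  load : ℕ → ℕ → ℕ → ℚ
  load i m k = S p m - S p i + S d k - S d m

  -- best i k t : the largest index m ∈ {i,…,i+t} maximizing load(i,m,k)
  best : ℕ → ℕ → ℕ → ℕ
  best i k zero    = i
  best i k (suc t) =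
    let b = best i k t
        m = i ℕ.+ suc t
    in if load i b k ≤ᵇ load i m k then m else b

  highest : ℕ → ℕ → ℕ
  highest i k = best i k (k ∸ i)

  pen : ℚ → ℚ → ℕ → ℕ → ℚ
  pen Q α i k = α * ((load i (highest i k) k - Q) ⊔ 0ℚ)

-- Write M(i,k) = load(i, highest(i,k), k) for the maximal load of the route segment (i,k].
-- Appending customer k+1 adds d_{k+1} to every load(i,m,k) and offers the single new
-- candidate m = k+1, so highest(i,k+1) is either highest(i,k) or k+1.  Since the
-- highest index of j moves, it is k+1, and M(j,k+1) = P[k+1] - P[j].  If the highest
-- index of i stays, M(i,·) grows by exactly d_{k+1}, which is at most the growth of M(j,·);
-- if it moves, M(i,k+1) = M(j,k+1) + P[j] - P[i] while M(i,k) ≥ M(j,k) + P[j] - P[i].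
-- Either way M(i,k+1) - M(i,k) ≤ M(j,k+1) - M(j,k), and positive penalties mean that all
-- four maximal loads lie above Q, where the penalty is the affine map y ↦ α (y - Q).
module Submission where

open import Defs
open import Data.Nat using (ℕ; suc; _≤_) renaming (_<_ to _<ℕ_)
open import Data.Rational using (ℚ; 0ℚ; _-_; _<_) renaming (_≤_ to _≤ℚ_)
open import Relation.Binary.PropositionalEquality using (_≢_)

import Data.Nat as ℕ
import Data.Nat.Properties as ℕP
open import Data.Rational using (_+_; _*_; -_; _⊔_; _≤ᵇ_; nonNegative)
import Data.Rational.Properties as ℚP
open import Data.Rational.Solver using (module +-*-Solver)
open +-*-Solver using (solve; _:+_; _:-_; _:*_; _:=_)
open import Data.Bool using (true; false; T; if_then_else_)
open import Data.Bool.Properties using (T-≡; ⇔→≡)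
open import Data.Empty using (⊥-elim)
open import Data.Sum using (_⊎_; inj₁; inj₂)
open import Function using (_∘_; mk⇔)
open import Function.Bundles using (module Equivalence)
open import Relation.Binary.PropositionalEquality
  using (_≡_; refl; sym; trans; cong; cong₂; subst; subst₂; module ≡-Reasoning)

+-cancelʳ-≤ : ∀ r {p q} → p + r ≤ℚ q + r → p ≤ℚ q
+-cancelʳ-≤ r {p} {q} h = subst₂ _≤ℚ_ (cancel p) (cancel q) (ℚP.+-monoˡ-≤ (- r) h)
  where
  cancel : ∀ x → x + r + - r ≡ x
  cancel x = solve 2 (λ x r → x :+ r :- r := x) refl x r

p≤q⇒0≤q-p : ∀ {p q} → p ≤ℚ q → 0ℚ ≤ℚ q - p
p≤q⇒0≤q-p {p} {q} h = +-cancelʳ-≤ p (subst₂ _≤ℚ_ (sym (ℚP.+-identityˡ p)) eq h)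
  where
  eq : q ≡ q - p + p
  eq = solve 2 (λ p q → q := q :- p :+ p) refl p q

0≤q-p⇒p≤q : ∀ {p q} → 0ℚ ≤ℚ q - p → p ≤ℚ q
0≤q-p⇒p≤q {p} {q} h = subst₂ _≤ℚ_ (ℚP.+-identityˡ p) eq (ℚP.+-monoˡ-≤ p h)
  where
  eq : q - p + p ≡ q
  eq = solve 2 (λ p q → q :- p :+ p := q) refl p q

p≤p+q : ∀ p {q} → 0ℚ ≤ℚ q → p ≤ℚ p + q
p≤p+q p h = subst (_≤ℚ p + _) (ℚP.+-identityʳ p) (ℚP.+-monoʳ-≤ p h)

p+s≤q+r⇒p-r≤q-s : ∀ {p q r s} → p + s ≤ℚ q + r → p - r ≤ℚ q - s
p+s≤q+r⇒p-r≤q-s {p} {q} {r} {s} h = +-cancelʳ-≤ (r + s) (subst₂ _≤ℚ_ left right h)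
  where
  left : p + s ≡ p - r + (r + s)
  left = solve 3 (λ p r s → p :+ s := p :- r :+ (r :+ s)) refl p r s
  right : q + r ≡ q - s + (r + s)
  right = solve 3 (λ q r s → q :+ r := q :- s :+ (r :+ s)) refl q r s

≤ᵇ-true⇒≤ : ∀ {p q} → (p ≤ᵇ q) ≡ true → p ≤ℚ q
≤ᵇ-true⇒≤ = ℚP.≤ᵇ⇒≤ ∘ Equivalence.from T-≡

≤ᵇ-false⇒≥ : ∀ {p q} → (p ≤ᵇ q) ≡ false → q ≤ℚ p
≤ᵇ-false⇒≥ eq = ℚP.<⇒≤ (ℚP.≰⇒> (λ h → subst T eq (ℚP.≤⇒≤ᵇ h)))

+-shift-≤ᵇ : ∀ r p q → (p + r ≤ᵇ q + r) ≡ (p ≤ᵇ q)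
+-shift-≤ᵇ r p q = ⇔→≡ (mk⇔ (λ h → ≤⇒≡true (+-cancelʳ-≤ r {p} {q} (≤ᵇ-true⇒≤ h)))
                            (λ h → ≤⇒≡true (ℚP.+-monoˡ-≤ r {p} {q} (≤ᵇ-true⇒≤ h))))
  where
  ≤⇒≡true : ∀ {x y} → x ≤ℚ y → (x ≤ᵇ y) ≡ true
  ≤⇒≡true = Equivalence.to T-≡ ∘ ℚP.≤⇒≤ᵇ

excess : ℚ → ℚ → ℚ → ℚ
excess Q α y = α * ((y - Q) ⊔ 0ℚ)

excess-affine : ∀ Q α {y} → Q ≤ℚ y → excess Q α y ≡ α * (y - Q)
excess-affine Q α h = cong (α *_) (ℚP.p≥q⇒p⊔q≡p (p≤q⇒0≤q-p h))

excess-pos⇒≤ : ∀ Q α y → 0ℚ < excess Q α y → Q ≤ℚ y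
excess-pos⇒≤ Q α y h with ℚP.≤-total (y - Q) 0ℚ
... | inj₂ 0≤y-Q = 0≤q-p⇒p≤q 0≤y-Q
... | inj₁ y-Q≤0 = ⊥-elim (ℚP.<-irrefl refl (subst (0ℚ <_) excess≡0 h))
  where
  excess≡0 : excess Q α y ≡ 0ℚ
  excess≡0 = trans (cong (α *_) (ℚP.p≤q⇒p⊔q≡q y-Q≤0)) (ℚP.*-zeroʳ α)

excess-increment-mono : ∀ {Q α A a B b} → 0ℚ ≤ℚ α
  → Q ≤ℚ A → Q ≤ℚ a → Q ≤ℚ B → Q ≤ℚ b → A + b ≤ℚ B + a
  → excess Q α A - excess Q α a ≤ℚ excess Q α B - excess Q α b
excess-increment-mono {Q} {α} {A} {a} {B} {b} 0≤α Q≤A Q≤a Q≤B Q≤b h =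
  subst₂ _≤ℚ_ (increment Q≤A Q≤a) (increment Q≤B Q≤b)
    (ℚP.*-monoˡ-≤-nonNeg α (p+s≤q+r⇒p-r≤q-s {A} {B} {a} {b} h))
  where
  instance _ = nonNegative 0≤α
  affine-diff : ∀ y z → α * (y - z) ≡ α * (y - Q) - α * (z - Q)
  affine-diff y z = solve 4 (λ α Q y z → α :* (y :- z) := α :* (y :- Q) :- α :* (z :- Q)) refl α Q y z
  increment : ∀ {y z} → Q ≤ℚ y → Q ≤ℚ z → α * (y - z) ≡ excess Q α y - excess Q α z
  increment {y} {z} Q≤y Q≤z = trans (affine-diff y z)
    (sym (cong₂ _-_ (excess-affine Q α Q≤y) (excess-affine Q α Q≤z)))

m≤n+1+o⇒m≤n+o∨m≡n+1+o : ∀ {m n o} → m ≤ n ℕ.+ suc o → m ≤ n ℕ.+ o ⊎ m ≡ n ℕ.+ suc o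
m≤n+1+o⇒m≤n+o∨m≡n+1+o {m} {n} {o} m≤n+1+o with ℕP.m≤n⇒m<n∨m≡n m≤n+1+o
... | inj₁ m<n+1+o = inj₁ (ℕP.m<1+n⇒m≤n (subst (m ℕ.<_) (ℕP.+-suc n o) m<n+1+o))
... | inj₂ m≡n+1+o = inj₂ m≡n+1+o

module _ (d p : ℕ → ℚ) where

  load-suc : ∀ i m k → load d p i m (suc k) ≡ load d p i m k + d (suc k)
  load-suc i m k = solve 5 (λ Pm Pi Dk d Dm → Pm :- Pi :+ (Dk :+ d) :- Dm := Pm :- Pi :+ Dk :- Dm :+ d)
    refl (S p m) (S p i) (S d k) (d (suc k)) (S d m)

  load-rebase : ∀ i j m k → load d p i m k ≡ load d p j m k + (S p j - S p i)
  load-rebase i j m k = solve 5 (λ Pm Pi Dk Pj Dm → Pm :- Pi :+ Dk :- Dm := Pm :- Pj :+ Dk :- Dm :+ (Pj :- Pi))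
    refl (S p m) (S p i) (S d k) (S p j) (S d m)

  best-≥ : ∀ i k t → i ≤ best d p i k t
  best-≥ i k ℕ.zero = ℕP.≤-refl
  best-≥ i k (suc t) with load d p i (best d p i k t) k ≤ᵇ load d p i (i ℕ.+ suc t) k
  ... | true  = ℕP.m≤m+n i (suc t)
  ... | false = best-≥ i k t

  best-≤ : ∀ i k t → best d p i k t ≤ i ℕ.+ t
  best-≤ i k ℕ.zero = ℕP.m≤m+n i 0
  best-≤ i k (suc t) with load d p i (best d p i k t) k ≤ᵇ load d p i (i ℕ.+ suc t) k
  ... | true  = ℕP.≤-refl
  ... | false = ℕP.≤-trans (best-≤ i k t) (ℕP.+-monoʳ-≤ i (ℕP.n≤1+n t))

  best-maximal : ∀ i k t m → i ≤ m → m ≤ i ℕ.+ t → load d p i m k ≤ℚ load d p i (best d p i k t) k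
  best-maximal i k ℕ.zero m i≤m m≤i+0 rewrite ℕP.≤-antisym (subst (m ≤_) (ℕP.+-identityʳ i) m≤i+0) i≤m =
    ℚP.≤-refl
  best-maximal i k (suc t) m i≤m m≤i+1+t
    with load d p i (best d p i k t) k ≤ᵇ load d p i (i ℕ.+ suc t) k in eq | m≤n+1+o⇒m≤n+o∨m≡n+1+o m≤i+1+t
  ... | true  | inj₁ m≤i+t = ℚP.≤-trans (best-maximal i k t m i≤m m≤i+t) (≤ᵇ-true⇒≤ eq)
  ... | true  | inj₂ refl  = ℚP.≤-refl
  ... | false | inj₁ m≤i+t = best-maximal i k t m i≤m m≤i+t
  ... | false | inj₂ refl  = ≤ᵇ-false⇒≥ eq

  best-suc-load : ∀ i k t → best d p i (suc k) t ≡ best d p i k t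
  best-suc-load i k ℕ.zero = refl
  best-suc-load i k (suc t) = begin
    choose (best d p i (suc k) t) (suc k)  ≡⟨ cong (λ b → choose b (suc k)) (best-suc-load i k t) ⟩
    choose (best d p i k t) (suc k)        ≡⟨ cong (λ c → if c then m else best d p i k t) same-comparison ⟩
    choose (best d p i k t) k              ∎
    where
    open ≡-Reasoning
    m : ℕ
    m = i ℕ.+ suc t
    choose : ℕ → ℕ → ℕ
    choose b k′ = if load d p i b k′ ≤ᵇ load d p i m k′ then m else b
    same-comparison : (load d p i (best d p i k t) (suc k) ≤ᵇ load d p i m (suc k))
                    ≡ (load d p i (best d p i k t) k ≤ᵇ load d p i m k)
    same-comparison = trans (cong₂ _≤ᵇ_ (load-suc i (best d p i k t) k) (load-suc i m k))
                            (+-shift-≤ᵇ (d (suc k)) (load d p i (best d p i k t) k) (load d p i m k))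

  best-suc : ∀ i k t → best d p i k (suc t) ≡ best d p i k t ⊎ best d p i k (suc t) ≡ i ℕ.+ suc t
  best-suc i k t with load d p i (best d p i k t) k ≤ᵇ load d p i (i ℕ.+ suc t) k
  ... | true  = inj₂ refl
  ... | false = inj₁ refl

  highest-≥ : ∀ i k → i ≤ highest d p i k
  highest-≥ i k = best-≥ i k (k ℕ.∸ i)

  highest-≤ : ∀ {i k} → i ≤ k → highest d p i k ≤ k
  highest-≤ {i} {k} i≤k = subst (highest d p i k ≤_) (ℕP.m+[n∸m]≡n i≤k) (best-≤ i k (k ℕ.∸ i))

  highest-maximal : ∀ {i m k} → i ≤ m → m ≤ k → load d p i m k ≤ℚ load d p i (highest d p i k) k
  highest-maximal {i} {m} {k} i≤m m≤k =
    best-maximal i k (k ℕ.∸ i) m i≤m (subst (m ≤_) (sym (ℕP.m+[n∸m]≡n (ℕP.≤-trans i≤m m≤k))) m≤k)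

  highest-suc : ∀ {i k} → i ≤ k → highest d p i (suc k) ≡ highest d p i k ⊎ highest d p i (suc k) ≡ suc k
  highest-suc {i} {k} i≤k rewrite ℕP.+-∸-assoc 1 i≤k with best-suc i (suc k) (k ℕ.∸ i)
  ... | inj₁ stays = inj₁ (trans stays (best-suc-load i k (k ℕ.∸ i)))
  ... | inj₂ jumps = inj₂ (trans jumps (trans (ℕP.+-suc i (k ℕ.∸ i)) (cong suc (ℕP.m+[n∸m]≡n i≤k))))

  -- pen d p Q α i k is definitionally excess Q α (maxLoad i k).
  maxLoad : ℕ → ℕ → ℚ
  maxLoad i k = load d p i (highest d p i k) k

  maxLoad-suc-≥ : ∀ {i k} → i ≤ k → maxLoad i k + d (suc k) ≤ℚ maxLoad i (suc k)
  maxLoad-suc-≥ {i} {k} i≤k = subst (_≤ℚ maxLoad i (suc k)) (load-suc i (highest d p i k) k)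
    (highest-maximal (highest-≥ i k) (ℕP.m≤n⇒m≤1+n (highest-≤ i≤k)))

  maxLoad-suc-mono : ∀ {i k} → 0ℚ ≤ℚ d (suc k) → i ≤ k → maxLoad i k ≤ℚ maxLoad i (suc k)
  maxLoad-suc-mono {i} {k} 0≤d i≤k = ℚP.≤-trans (p≤p+q (maxLoad i k) 0≤d) (maxLoad-suc-≥ i≤k)

  maxLoad-rebase-≥ : ∀ {i j k} → i ≤ j → j ≤ k → maxLoad j k + (S p j - S p i) ≤ℚ maxLoad i k
  maxLoad-rebase-≥ {i} {j} {k} i≤j j≤k = subst (_≤ℚ maxLoad i k) (load-rebase i j (highest d p j k) k)
    (highest-maximal (ℕP.≤-trans i≤j (highest-≥ j k)) (highest-≤ j≤k))

  maxLoad-increment-≤ : ∀ {i j k} → i ≤ j → j ≤ k → highest d p j k ≢ highest d p j (suc k)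
    → maxLoad i (suc k) + maxLoad j k ≤ℚ maxLoad j (suc k) + maxLoad i k
  maxLoad-increment-≤ {i} {j} {k} i≤j j≤k j-moves with highest-suc (ℕP.≤-trans i≤j j≤k)
  ... | inj₁ i-stays = begin
    maxLoad i (suc k) + maxLoad j k                ≡⟨ cong (_+ maxLoad j k) i-grows-by-d ⟩
    maxLoad i k + d (suc k) + maxLoad j k          ≡⟨ swap (maxLoad i k) (d (suc k)) (maxLoad j k) ⟩
    maxLoad j k + d (suc k) + maxLoad i k          ≤⟨ ℚP.+-monoˡ-≤ (maxLoad i k) (maxLoad-suc-≥ j≤k) ⟩
    maxLoad j (suc k) + maxLoad i k                ∎
    where
    open ℚP.≤-Reasoning
    swap : ∀ x y z → x + y + z ≡ z + y + x
    swap = solve 3 (λ x y z → x :+ y :+ z := z :+ y :+ x) refl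
    i-grows-by-d : maxLoad i (suc k) ≡ maxLoad i k + d (suc k)
    i-grows-by-d = trans (cong (λ m → load d p i m (suc k)) i-stays) (load-suc i (highest d p i k) k)
  ... | inj₂ i-jumps = begin
    maxLoad i (suc k) + maxLoad j k                ≡⟨ cong (_+ maxLoad j k) i-is-rebased-j ⟩
    maxLoad j (suc k) + s + maxLoad j k            ≡⟨ regroup (maxLoad j (suc k)) s (maxLoad j k) ⟩
    maxLoad j (suc k) + (maxLoad j k + s)          ≤⟨ ℚP.+-monoʳ-≤ (maxLoad j (suc k)) (maxLoad-rebase-≥ i≤j j≤k) ⟩
    maxLoad j (suc k) + maxLoad i k                ∎
    where
    open ℚP.≤-Reasoning
    s : ℚ
    s = S p j - S p i
    regroup : ∀ x y z → x + y + z ≡ x + (z + y)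
    regroup = solve 3 (λ x y z → x :+ y :+ z := x :+ (z :+ y)) refl
    j-jumps : highest d p j (suc k) ≡ suc k
    j-jumps with highest-suc j≤k
    ... | inj₁ j-stays = ⊥-elim (j-moves (sym j-stays))
    ... | inj₂ j-jumps = j-jumps
    i-is-rebased-j : maxLoad i (suc k) ≡ maxLoad j (suc k) + s
    i-is-rebased-j = begin-equality
      load d p i (highest d p i (suc k)) (suc k)   ≡⟨ cong (λ m → load d p i m (suc k)) i-jumps ⟩
      load d p i (suc k) (suc k)                   ≡⟨ load-rebase i j (suc k) (suc k) ⟩
      load d p j (suc k) (suc k) + s               ≡⟨ cong (λ m → load d p j m (suc k) + s) (sym j-jumps) ⟩
      maxLoad j (suc k) + s                        ∎

lemma3 : (n : ℕ) (d p : ℕ → ℚ) (Q α : ℚ)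
           → (∀ z → 1 ≤ z → z ≤ n → 0ℚ ≤ℚ d z)
           → (∀ z → 1 ≤ z → z ≤ n → 0ℚ ≤ℚ p z)
           → 0ℚ ≤ℚ Q → 0ℚ ≤ℚ α
           → (i j x : ℕ) → i <ℕ j → j <ℕ x → x <ℕ n
           → 0ℚ < pen d p Q α i x
           → 0ℚ < pen d p Q α j x
           → highest d p j x ≢ highest d p j (suc x)
           → pen d p Q α i (suc x) - pen d p Q α i x
               ≤ℚ pen d p Q α j (suc x) - pen d p Q α j x
lemma3 n d p Q α 0≤d _ _ 0≤α i j x i<j j<x x<n pen-i>0 pen-j>0 j-moves =
  excess-increment-mono 0≤α (above-Q-suc i≤x Q≤Mi) Q≤Mi (above-Q-suc j≤x Q≤Mj) Q≤Mj
    (maxLoad-increment-≤ d p (ℕP.<⇒≤ i<j) j≤x j-moves)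
  where
  j≤x : j ≤ x
  j≤x = ℕP.<⇒≤ j<x
  i≤x : i ≤ x
  i≤x = ℕP.<⇒≤ (ℕP.<-trans i<j j<x)
  Q≤Mi : Q ≤ℚ maxLoad d p i x
  Q≤Mi = excess-pos⇒≤ Q α (maxLoad d p i x) pen-i>0
  Q≤Mj : Q ≤ℚ maxLoad d p j x
  Q≤Mj = excess-pos⇒≤ Q α (maxLoad d p j x) pen-j>0
  above-Q-suc : ∀ {k} → k ≤ x → Q ≤ℚ maxLoad d p k x → Q ≤ℚ maxLoad d p k (suc x)
  above-Q-suc k≤x Q≤M = ℚP.≤-trans Q≤M (maxLoad-suc-mono d p (0≤d (suc x) (ℕ.s≤s ℕ.z≤n) x<n) k≤x)
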